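{- Let $G$ be an $S_{2,2}$-free outerplanar graph with at least $6$ vertices. For any vertices $x,y$ of $G$ with $xy\in E(G)$, $d_G(x)\ge 3$ and $d_G(y)\ge 3$, we have $|N_G(x)\cap N_G(y)|\ge 1$.
   Context: All graphs are finite, simple and undirected. The double star $S_{2,2}$ is the graph obtained from an edge $xy$ by joining each of $x$ and $y$ to two new vertices (6 vertices in total). A graph is $S_{2,2}$-free if it contains no subgraph isomorphic to $S_{2,2}$. A graph is outerplanar if it has a planar embedding with all vertices on the boundary of the outer face. $N_G(v)$ is the neighbourhood and $d_G(v)$ the degree of $v$ in $G$. -}

module Defs where

open import Data.Nat using (ℕ; zero; suc; _<_; _≥_)
open import Data.Fin using (Fin; toℕ)
open import Data.Fin.Properties using ()
open import Data.Bool using (Bool; true; false; _∨_)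
open import Data.Bool.Properties using (∨-comm)
open import Data.List using (List; length; filterᵇ; allFin)
open import Data.Product using (Σ; ∃; _×_; _,_)
open import Data.Empty using (⊥)
open import Relation.Binary.PropositionalEquality using (_≡_; refl)
open import Function.Definitions using (Injective)

record Graph (n : ℕ) : Set where
  field
    adj    : Fin n → Fin n → Bool
    sym    : ∀ i j → adj i j ≡ adj j i
    irrefl : ∀ i → adj i i ≡ false
open Graph public

Edge : ∀ {n} → Graph n → Fin n → Fin n → Set
Edge G x y = adj G x y ≡ true

degree : ∀ {n} → Graph n → Fin n → ℕ
degree {n} G x = length (filterᵇ (adj G x) (allFin n))

-- H is isomorphic to a (not necessarily induced) subgraph of G:
-- an injective vertex map sending edges to edges.
ContainsSubgraph : ∀ {m n} → Graph m → Graph n → Set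
ContainsSubgraph {m} {n} H G =
  Σ (Fin m → Fin n) λ f →
    Injective _≡_ _≡_ f × (∀ i j → Edge H i j → Edge G (f i) (f j))

private
  e : ℕ → ℕ → Bool
  e 0 1 = true
  e 0 2 = true
  e 0 3 = true
  e 1 4 = true
  e 1 5 = true
  e _ _ = false

  s22adj : Fin 6 → Fin 6 → Bool
  s22adj i j = e (toℕ i) (toℕ j) ∨ e (toℕ j) (toℕ i)

  s22irr : ∀ i → s22adj i i ≡ false
  s22irr Fin.zero = refl
  s22irr (Fin.suc Fin.zero) = refl
  s22irr (Fin.suc (Fin.suc Fin.zero)) = refl
  s22irr (Fin.suc (Fin.suc (Fin.suc Fin.zero))) = refl
  s22irr (Fin.suc (Fin.suc (Fin.suc (Fin.suc Fin.zero)))) = refl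
  s22irr (Fin.suc (Fin.suc (Fin.suc (Fin.suc (Fin.suc Fin.zero))))) = refl

S22 : Graph 6
S22 = record
  { adj = s22adj
  ; sym = λ i j → ∨-comm (e (toℕ i) (toℕ j)) (e (toℕ j) (toℕ i))
  ; irrefl = s22irr
  }

S22-free : ∀ {n} → Graph n → Set
S22-free G = ContainsSubgraph S22 G → ⊥

-- Outerplanar (combinatorial form of "embedding with all vertices on the
-- outer face"): the vertices can be placed in a cyclic order on a circle
-- (positions given by an injective map pos) so that no two edges, drawn as
-- chords, cross; i.e. there are no edges uv, wz with
-- pos u < pos w < pos v < pos z.
Outerplanar : ∀ {n} → Graph n → Set
Outerplanar {n} G =
  Σ (Fin n → Fin n) λ pos →
    Injective _≡_ _≡_ pos ×
    (∀ u v w z → Edge G u v → Edge G w z →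
       toℕ (pos u) < toℕ (pos w) → toℕ (pos w) < toℕ (pos v) →
       toℕ (pos v) < toℕ (pos z) → ⊥)

{-# OPTIONS --safe #-}
module Submission where

-- If the edge xy had no common neighbour, then
-- two neighbours a₁, a₂ of x other than y and two neighbours b₁, b₂ of y other
-- than x would be six distinct vertices (aᵢ = bⱼ would be a common neighbour),
-- and together with x, y they span an S₂,₂.

open import Defs
open import Data.Nat using (_≥_; s≤s)
open import Data.Fin using (Fin; zero; suc; _≟_)
open import Data.Fin.Properties using (any?; all?)
open import Data.Bool using (true; T?)
import Data.Bool.Properties as Bool
open import Data.Product using (∃; ∃₂; _×_; _,_)
open import Data.Product.Properties using (≡-dec)
open import Data.Sum using (_⊎_; inj₁; inj₂)
open import Data.Empty using (⊥; ⊥-elim)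
open import Data.List using (List; []; _∷_; length; allFin)
open import Data.List.Relation.Unary.All as All using (All; []; _∷_)
open import Data.List.Relation.Unary.All.Properties using (all-filter)
open import Data.List.Relation.Unary.AllPairs using ([]; _∷_)
import Data.List.Relation.Unary.Unique.Propositional as List
open import Data.List.Relation.Unary.Unique.Propositional.Properties using (allFin⁺; filter⁺)
open import Data.List.Membership.DecPropositional {A = Fin 6 × Fin 6} (≡-dec _≟_ _≟_)
  using (_∈_; _∈?_)
open import Data.Vec using ([]; _∷_; lookup)
open import Data.Vec.Relation.Unary.All using ([]; _∷_)
open import Data.Vec.Relation.Unary.AllPairs using ([]; _∷_)
import Data.Vec.Relation.Unary.Unique.Propositional as Vec
open import Data.Vec.Relation.Unary.Unique.Propositional.Properties using (lookup-injective)
open import Function using (_∘_; Equivalence)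
open import Relation.Binary using (DecidableEquality)
open import Relation.Binary.PropositionalEquality using (_≢_; refl; trans; ≢-sym)
  renaming (sym to ≡-sym)
open import Relation.Nullary using (yes; no)
open import Relation.Nullary.Decidable using (_×-dec_; _⊎-dec_; _→-dec_; toWitness)

two-distinct-other-than : ∀ {A : Set} {P : A → Set} → DecidableEquality A → (y : A) →
  ∀ {xs} → List.Unique xs → All P xs → length xs ≥ 3 →
  ∃₂ λ u v → P u × P v × u ≢ v × u ≢ y × v ≢ y
two-distinct-other-than _ _ {[]}         _ _ ()
two-distinct-other-than _ _ {_ ∷ []}     _ _ (s≤s ())
two-distinct-other-than _ _ {_ ∷ _ ∷ []} _ _ (s≤s (s≤s ()))
two-distinct-other-than _≟_ y {a ∷ b ∷ c ∷ _}
  ((a≢b ∷ a≢c ∷ _) ∷ (b≢c ∷ _) ∷ _) (pa ∷ pb ∷ pc ∷ _) _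
  with a ≟ y | b ≟ y
... | yes refl | _        = b , c , pb , pc , b≢c , ≢-sym a≢b , ≢-sym a≢c
... | no a≢y   | yes refl = a , c , pa , pc , a≢c , a≢y , ≢-sym b≢c
... | no a≢y   | no b≢y   = a , b , pa , pb , a≢b , a≢y , b≢y

module _ {n} (G : Graph n) where

  Edge-sym : ∀ {u v} → Edge G u v → Edge G v u
  Edge-sym {u} {v} = trans (Graph.sym G v u)

  Edge⇒≢ : ∀ {u v} → Edge G u v → u ≢ v
  Edge⇒≢ {u} u~u refl with trans (≡-sym u~u) (irrefl G u)
  ... | ()

  two-neighbours-other-than : ∀ {x} → degree G x ≥ 3 → ∀ y →
    ∃₂ λ u v → Edge G x u × Edge G x v × u ≢ v × u ≢ y × v ≢ y
  two-neighbours-other-than {x} dx y =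
    two-distinct-other-than _≟_ y (filter⁺ (T? ∘ adj G x) (allFin⁺ n))
      (All.map (Equivalence.to Bool.T-≡) (all-filter (T? ∘ adj G x) (allFin n))) dx

pattern v₀ = zero
pattern v₁ = suc zero
pattern v₂ = suc (suc zero)
pattern v₃ = suc (suc (suc zero))
pattern v₄ = suc (suc (suc (suc zero)))
pattern v₅ = suc (suc (suc (suc (suc zero))))

S22-arcs : List (Fin 6 × Fin 6)
S22-arcs = (v₀ , v₁) ∷ (v₀ , v₂) ∷ (v₀ , v₃) ∷ (v₁ , v₄) ∷ (v₁ , v₅) ∷ []

S22-edge⇒arc : ∀ i j → Edge S22 i j → (i , j) ∈ S22-arcs ⊎ (j , i) ∈ S22-arcs
S22-edge⇒arc = toWitness {a? = all? λ i → all? λ j →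
  (adj S22 i j Bool.≟ true) →-dec ((i , j) ∈? S22-arcs ⊎-dec (j , i) ∈? S22-arcs)} _

record DoubleStar {n} (G : Graph n) : Set where
  field
    x y a₁ a₂ b₁ b₂ : Fin n
    x~y  : Edge G x y
    x~a₁ : Edge G x a₁
    x~a₂ : Edge G x a₂
    y~b₁ : Edge G y b₁
    y~b₂ : Edge G y b₂
    distinct : Vec.Unique (x ∷ y ∷ a₁ ∷ a₂ ∷ b₁ ∷ b₂ ∷ [])

DoubleStar⇒S22 : ∀ {n} {G : Graph n} → DoubleStar G → ContainsSubgraph S22 G
DoubleStar⇒S22 {n} {G} D = embed , lookup-injective distinct _ _ , preserves-edges
  where
  open DoubleStar D

  embed : Fin 6 → Fin n
  embed = lookup (x ∷ y ∷ a₁ ∷ a₂ ∷ b₁ ∷ b₂ ∷ [])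

  arcs-present : All (λ (i , j) → Edge G (embed i) (embed j)) S22-arcs
  arcs-present = x~y ∷ x~a₁ ∷ x~a₂ ∷ y~b₁ ∷ y~b₂ ∷ []

  preserves-edges : ∀ i j → Edge S22 i j → Edge G (embed i) (embed j)
  preserves-edges i j i~j with S22-edge⇒arc i j i~j
  ... | inj₁ ij∈ = All.lookup arcs-present ij∈
  ... | inj₂ ji∈ = Edge-sym G (All.lookup arcs-present ji∈)

no-common-neighbour⇒DoubleStar : ∀ {n} (G : Graph n) {x y} → Edge G x y →
  degree G x ≥ 3 → degree G y ≥ 3 → (∀ z → Edge G x z → Edge G y z → ⊥) → DoubleStar G
no-common-neighbour⇒DoubleStar G {x} {y} x~y dx dy no-common
  with two-neighbours-other-than G dx y | two-neighbours-other-than G dy x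
... | a₁ , a₂ , x~a₁ , x~a₂ , a₁≢a₂ , a₁≢y , a₂≢y
    | b₁ , b₂ , y~b₁ , y~b₂ , b₁≢b₂ , b₁≢x , b₂≢x = record
  { x~y = x~y ; x~a₁ = x~a₁ ; x~a₂ = x~a₂ ; y~b₁ = y~b₁ ; y~b₂ = y~b₂
  ; distinct =
      (Edge⇒≢ G x~y ∷ Edge⇒≢ G x~a₁ ∷ Edge⇒≢ G x~a₂ ∷ ≢-sym b₁≢x ∷ ≢-sym b₂≢x ∷ []) ∷
      (≢-sym a₁≢y ∷ ≢-sym a₂≢y ∷ Edge⇒≢ G y~b₁ ∷ Edge⇒≢ G y~b₂ ∷ []) ∷
      (a₁≢a₂ ∷ leaves-apart x~a₁ y~b₁ ∷ leaves-apart x~a₁ y~b₂ ∷ []) ∷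
      (leaves-apart x~a₂ y~b₁ ∷ leaves-apart x~a₂ y~b₂ ∷ []) ∷
      (b₁≢b₂ ∷ []) ∷ [] ∷ []
  }
  where
  leaves-apart : ∀ {a b} → Edge G x a → Edge G y b → a ≢ b
  leaves-apart x~a y~b refl = no-common _ x~a y~b

lemma5 : ∀ {n} (G : Graph n) → S22-free G → Outerplanar G → n ≥ 6 →
    ∀ (x y : Fin n) → Edge G x y → degree G x ≥ 3 → degree G y ≥ 3 →
    ∃ λ z → Edge G x z × Edge G y z
lemma5 G S22-free-G _ _ x y x~y dx dy
  with any? (λ z → (adj G x z Bool.≟ true) ×-dec (adj G y z Bool.≟ true))
... | yes common = common
... | no ¬common = ⊥-elim (S22-free-G (DoubleStar⇒S22
        (no-common-neighbour⇒DoubleStar G x~y dx dy λ z x~z y~z → ¬common (z , x~z , y~z))))
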